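{- Let $G$ be a finite simple graph, $t\ge 2$, and let $C\subseteq V(G)$ with $G[C]$ connected and $|C|=t-1$, and let $w\in N_G(C)$. Then \[\nu_t\big(G\setminus (N_G[C]\cup N_G[w])\big)\le \nu_t(G)-1.\]
   Context: $G[W]$ is the induced subgraph on $W$; for $S\subseteq V(G)$, $G\setminus S$ is the induced subgraph on $V(G)\setminus S$. $N_G(C)=\{v\in V(G)\setminus C\mid \{v,u\}\in E(G)\text{ for some }u\in C\}$, $N_G[C]=N_G(C)\cup C$, and $N_G[w]=N_G(w)\cup\{w\}$. A $t$-induced matching of a graph $H$ is a collection $\{C_1,\ldots,C_r\}$ of pairwise disjoint subsets of $V(H)$ with $|C_i|=t$ and $H[C_i]$ connected for each $i$, such that $E(H[\bigcup_i C_i])=\bigcup_i E(H[C_i])$; $\nu_t(H)$ is the maximum size of a $t$-induced matching of $H$ (the empty collection is allowed, so $\nu_t(H)\ge 0$). -}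

module Defs where

open import Level using (0ℓ)
open import Data.Nat using (ℕ; _≤_; _∸_)
open import Data.Fin using (Fin)
open import Data.List using (List; length)
open import Data.List.Membership.Propositional using (_∈_)
open import Data.List.Relation.Unary.Unique.Propositional using (Unique)
open import Data.Product using (Σ; ∃; _×_)
open import Data.Sum using (_⊎_)
open import Relation.Nullary using (¬_)
open import Relation.Binary.PropositionalEquality using (_≡_; _≢_)

record Graph (n : ℕ) : Set₁ where
  field
    Adj   : Fin n → Fin n → Set
    sym   : ∀ {u v} → Adj u v → Adj v u
    irrefl : ∀ {u} → ¬ Adj u u
open Graph public

VSet : ℕ → Set₁
VSet n = Fin n → Set

-- Walks staying inside a list of vertices C (i.e. walks in G[C]).
data PathIn {n} (G : Graph n) (C : List (Fin n)) : Fin n → Fin n → Set where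
  here : ∀ {u} → u ∈ C → PathIn G C u u
  step : ∀ {u w v} → u ∈ C → Adj G u w → PathIn G C w v → PathIn G C u v

ConnectedIn : ∀ {n} → Graph n → List (Fin n) → Set
ConnectedIn G C = ∀ {u v} → u ∈ C → v ∈ C → PathIn G C u v

N : ∀ {n} → Graph n → List (Fin n) → VSet n
N G C v = ¬ (v ∈ C) × ∃ λ u → u ∈ C × Adj G v u

N[_,_] : ∀ {n} → Graph n → List (Fin n) → VSet n
N[ G , C ] v = v ∈ C ⊎ N G C v

Nv[_,_] : ∀ {n} → Graph n → Fin n → VSet n
Nv[ G , w ] v = v ≡ w ⊎ Adj G v w

-- A t-induced matching of size r of the induced subgraph G[W]:
-- blocks M i (i < r), each a duplicate-free list of exactly t vertices of W,
-- inducing a connected subgraph, pairwise disjoint, with no edges between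
-- distinct blocks (so the edges of the induced subgraph on the union are
-- exactly the union of the edges inside the blocks).
record InducedMatching {n} (G : Graph n) (W : VSet n) (t r : ℕ) : Set where
  field
    block      : Fin r → List (Fin n)
    inW        : ∀ i {v} → v ∈ block i → W v
    distinct   : ∀ i → Unique (block i)
    size       : ∀ i → length (block i) ≡ t
    connected  : ∀ i → ConnectedIn G (block i)
    disjoint   : ∀ i j {u v} → i ≢ j → u ∈ block i → v ∈ block j → u ≢ v
    noCross    : ∀ i j {u v} → i ≢ j → u ∈ block i → v ∈ block j → ¬ Adj G u v

IsNu : ∀ {n} → Graph n → VSet n → ℕ → ℕ → Set
IsNu G W t k = InducedMatching G W t k × (∀ r → InducedMatching G W t r → r ≤ k)

All : ∀ {n} → VSet n
All _ = Data.Unit.⊤ where import Data.Unit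

Outside : ∀ {n} → Graph n → List (Fin n) → Fin n → VSet n
Outside G C w v = ¬ (N[ G , C ] v ⊎ Nv[ G , w ] v)

-- Adding w to C gives a connected block w ∷ C of size t, and every vertex outside
-- N[C] ∪ N[w] is distinct from and non-adjacent to that block. Hence any t-induced
-- matching of G ∖ (N[C] ∪ N[w]) extends by the block w ∷ C to a t-induced matching of G
-- with one more block, so ν_t(G ∖ (N[C] ∪ N[w])) + 1 ≤ ν_t(G).
module Submission where

open import Defs
open import Data.Nat using (ℕ; _≤_; _∸_; suc; s≤s)
open import Data.Nat.Properties using (∸-monoˡ-≤)
open import Data.Fin using (Fin) renaming (zero to fzero; suc to fsuc)
open import Data.List using (List; length; _∷_)
open import Data.List.Membership.Propositional using (_∈_)
open import Data.List.Relation.Binary.Subset.Propositional using (_⊆_)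
open import Data.List.Relation.Unary.Any using (here; there)
open import Data.List.Relation.Unary.All.Properties using (¬Any⇒All¬)
open import Data.List.Relation.Unary.AllPairs using (_∷_)
open import Data.List.Relation.Unary.Unique.Propositional using (Unique)
open import Data.Product using (_×_; _,_; proj₁; proj₂)
open import Data.Sum using (inj₁; inj₂)
open import Data.Empty using (⊥-elim)
open import Relation.Nullary using (¬_)
open import Function using (_∘_)
open import Relation.Binary.PropositionalEquality using (_≡_; _≢_; refl; cong) renaming (sym to ≡-sym)

module _ {n} (G : Graph n) where

  PathIn-mono : ∀ {C D u v} → C ⊆ D → PathIn G C u v → PathIn G D u v
  PathIn-mono C⊆D (here u∈C)       = here (C⊆D u∈C)
  PathIn-mono C⊆D (step u∈C uw wv) = step (C⊆D u∈C) uw (PathIn-mono C⊆D wv)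

  PathIn-snoc : ∀ {C u v y} → PathIn G C u v → Adj G v y → y ∈ C → PathIn G C u y
  PathIn-snoc (here v∈C)       vy y∈C = step v∈C vy (here y∈C)
  PathIn-snoc (step u∈C uw wv) vy y∈C = step u∈C uw (PathIn-snoc wv vy y∈C)

  ConnectedIn-∷ : ∀ {C c w} → ConnectedIn G C → c ∈ C → Adj G w c → ConnectedIn G (w ∷ C)
  ConnectedIn-∷ conn c∈C wc (here refl) (here refl) = here (here refl)
  ConnectedIn-∷ conn c∈C wc (here refl) (there v∈C) = step (here refl) wc (PathIn-mono there (conn c∈C v∈C))
  ConnectedIn-∷ conn c∈C wc (there u∈C) (here refl) =
    PathIn-snoc (PathIn-mono there (conn u∈C c∈C)) (Graph.sym G wc) (here refl)
  ConnectedIn-∷ conn c∈C wc (there u∈C) (there v∈C) = PathIn-mono there (conn u∈C v∈C)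

  Separated : List (Fin n) → VSet n → Set
  Separated B W = ∀ {u v} → u ∈ B → W v → u ≢ v × ¬ Adj G u v

  Outside-separated : ∀ C w → Separated (w ∷ C) (Outside G C w)
  Outside-separated C w (here refl) out = (λ { refl → out (inj₂ (inj₁ refl)) })
                                        , (λ wv → out (inj₂ (inj₂ (Graph.sym G wv))))
  Outside-separated C w (there u∈C) out =
      (λ { refl → out (inj₁ (inj₁ u∈C)) })
    , (λ uv → out (inj₁ (inj₂ ((λ v∈C → out (inj₁ (inj₁ v∈C))) , _ , u∈C , Graph.sym G uv))))

  InducedMatching-∷ : ∀ {W W′ : VSet n} {t r} (B : List (Fin n)) →
    Unique B → length B ≡ t → ConnectedIn G B →
    (∀ {v} → v ∈ B → W′ v) → (∀ {v} → W v → W′ v) → Separated B W →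
    InducedMatching G W t r → InducedMatching G W′ t (suc r)
  InducedMatching-∷ {r = r} B uniqueB sizeB connB B⊆W′ W⊆W′ sep M = record
    { block     = blocks
    ; inW       = λ { fzero → B⊆W′ ; (fsuc i) → W⊆W′ ∘ inW i }
    ; distinct  = λ { fzero → uniqueB ; (fsuc i) → distinct i }
    ; size      = λ { fzero → sizeB ; (fsuc i) → size i }
    ; connected = λ { fzero → connB ; (fsuc i) → connected i }
    ; disjoint  = disjoint′
    ; noCross   = noCross′
    }
    where
    open InducedMatching M
    blocks : Fin (suc r) → List (Fin n)
    blocks fzero    = B
    blocks (fsuc i) = block i

    disjoint′ : ∀ i j {u v} → i ≢ j → u ∈ blocks i → v ∈ blocks j → u ≢ v
    disjoint′ fzero    fzero    i≢j = ⊥-elim (i≢j refl)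
    disjoint′ fzero    (fsuc j) _ u∈B v∈j = proj₁ (sep u∈B (inW j v∈j))
    disjoint′ (fsuc i) fzero    _ u∈i v∈B = λ u≡v → proj₁ (sep v∈B (inW i u∈i)) (≡-sym u≡v)
    disjoint′ (fsuc i) (fsuc j) i≢j = disjoint i j (λ i≡j → i≢j (cong fsuc i≡j))

    noCross′ : ∀ i j {u v} → i ≢ j → u ∈ blocks i → v ∈ blocks j → ¬ Adj G u v
    noCross′ fzero    fzero    i≢j = ⊥-elim (i≢j refl)
    noCross′ fzero    (fsuc j) _ u∈B v∈j = proj₂ (sep u∈B (inW j v∈j))
    noCross′ (fsuc i) fzero    _ u∈i v∈B = λ uv → proj₂ (sep v∈B (inW i u∈i)) (Graph.sym G uv)
    noCross′ (fsuc i) (fsuc j) i≢j = noCross i j (λ i≡j → i≢j (cong fsuc i≡j))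

lemma3p3 : ∀ {n} (G : Graph n) (t : ℕ) → 2 ≤ t →
    (C : List (Fin n)) → Unique C → ConnectedIn G C → length C ≡ t ∸ 1 →
    (w : Fin n) → N G C w →
    ∀ a b → IsNu G (Outside G C w) t a → IsNu G All t b → a ≤ b ∸ 1
lemma3p3 G (suc k) (s≤s _) C uniqueC connC sizeC w (w∉C , c , c∈C , wc) a b (Ma , _) (_ , maximal) =
  ∸-monoˡ-≤ 1 (maximal (suc a) (InducedMatching-∷ G (w ∷ C) uniqueWC (cong suc sizeC) connWC
                                   (λ _ → _) (λ _ → _) (Outside-separated G C w) Ma))
  where
  uniqueWC : Unique (w ∷ C)
  uniqueWC = ¬Any⇒All¬ C w∉C ∷ uniqueC

  connWC : ConnectedIn G (w ∷ C)
  connWC = ConnectedIn-∷ G connC c∈C wc
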